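{- Let $q$ be a prime power and $t,k,n$ integers with $1 \le t \le k < n$. Then $\mathcal{A}_q\left(n,k,t;q^{(n-k)(k-t)}\right) \ge q^{(n-k)k}$.
   Context: A $t$-$(n,k,\lambda)_q$ subspace packing is a collection of $k$-dimensional subspaces (blocks) of $\mathbb{F}_q^n$ such that every $t$-dimensional subspace of $\mathbb{F}_q^n$ is contained in at most $\lambda$ blocks. $\mathcal{A}_q(n,k,t;\lambda)$ denotes the maximum number of blocks of such a packing without repeated blocks (i.e., the blocks form a set). -}

module Defs where

open import Level using (0ℓ)
open import Data.Nat using (ℕ; zero; suc)
open import Data.Fin using (Fin; zero; suc)
open import Data.Product using (Σ; ∃; _×_; _,_)
open import Relation.Nullary using (¬_)
open import Relation.Binary.PropositionalEquality using (_≡_)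
import Relation.Binary.PropositionalEquality as ≡
open import Function.Bundles using (Inverse)
open import Function.Definitions using (Injective)
open import Algebra.Bundles using (CommutativeRing)

record FiniteField (q : ℕ) : Set₁ where
  field
    commRing  : CommutativeRing 0ℓ 0ℓ
  open CommutativeRing commRing public
  field
    1≉0       : ¬ (1# ≈ 0#)
    inverse   : ∀ x → ¬ (x ≈ 0#) → ∃ λ y → x * y ≈ 1#
    card      : Inverse setoid (≡.setoid (Fin q))

module LinAlg {q : ℕ} (F : FiniteField q) where
  open FiniteField F using (Carrier; _≈_; _+_; _*_; 0#)

  Vec : ℕ → Set
  Vec n = Fin n → Carrier

  Mat : ℕ → ℕ → Set
  Mat m n = Fin m → Vec n

  sumF : (m : ℕ) → (Fin m → Carrier) → Carrier
  sumF zero    f = 0#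
  sumF (suc m) f = f zero + sumF m (λ i → f (suc i))

  lincomb : ∀ {m n} → (Fin m → Carrier) → Mat m n → Vec n
  lincomb {m} c v j = sumF m (λ i → c i * v i j)

  _≈ᵥ_ : ∀ {n} → Vec n → Vec n → Set
  u ≈ᵥ w = ∀ j → u j ≈ w j

  zeroᵥ : ∀ {n} → Vec n
  zeroᵥ _ = 0#

  LinIndep : ∀ {m n} → Mat m n → Set
  LinIndep {m} v = ∀ (c : Fin m → Carrier) → lincomb c v ≈ᵥ zeroᵥ → ∀ i → c i ≈ 0#

  _∈span_ : ∀ {m n} → Vec n → Mat m n → Set
  _∈span_ {m} u v = ∃ λ (c : Fin m → Carrier) → lincomb c v ≈ᵥ u

  _⊆span_ : ∀ {a b n} → Mat a n → Mat b n → Set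
  A ⊆span B = ∀ i → A i ∈span B

  SameSpan : ∀ {a b n} → Mat a n → Mat b n → Set
  SameSpan A B = (A ⊆span B) × (B ⊆span A)

  record Subspace (n k : ℕ) : Set where
    constructor subspace
    field
      basis : Mat k n
      indep : LinIndep basis
  open Subspace public

  _≤ₛ_ : ∀ {n t k} → Subspace n t → Subspace n k → Set
  T ≤ₛ B = basis T ⊆span basis B

  _≡ₛ_ : ∀ {n k} → Subspace n k → Subspace n k → Set
  A ≡ₛ B = SameSpan (basis A) (basis B)

  -- A t-(n,k,λ)_q subspace packing without repeated blocks, with M blocks:
  -- M pairwise distinct k-subspaces such that each t-subspace lies in at most λ blocks.
  -- "at most λ blocks": any list of m distinct block indices all containing T has m ≤ λ.
  record Packing (n k t λ' M : ℕ) : Set where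
    field
      block    : Fin M → Subspace n k
      distinct : ∀ i j → block i ≡ₛ block j → i ≡ j
      packing  : ∀ (T : Subspace n t) (m : ℕ) (f : Fin m → Fin M) →
                 Injective _≡_ _≡_ f → (∀ l → T ≤ₛ block (f l)) → m Data.Nat.≤ λ'

  A≥ : (n k t λ' M : ℕ) → Set
  A≥ n k t λ' M = Packing n k t λ' M

module Submission where

-- Blocks.  For every k × m matrix A over F the block B_A is the row space of [ I_k | A ];
-- distinct matrices give distinct blocks, so there are q^(mk) of them.
--
-- Let T be a t-subspace with basis u_1 … u_t lying in some block, and let X be
-- the t × k matrix of the left parts of the u_i.  A vector lies in B_A iff its right part is its
-- left part times A, so X has independent rows, and if T ≤ B_A, T ≤ B_B then X (A - B) = 0:
-- every column of A - B lies in the kernel of X.  By Gaussian elimination (`kernelCoordinates`)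
-- the kernel of an independent t × k system is determined by at most k - t coordinates: a kernel
-- vector vanishing there is zero.  Hence a block through T is determined by the (≤ k - t) rows of
-- its matrix at those coordinates, and at most q^(m(k-t)) blocks contain T.
--
-- The construction works for every t.

open import Defs
open import Data.Nat as Nat using (ℕ; zero; suc; _≤_; z≤n; s≤s; NonZero)
open import Data.Nat.Properties using (^-monoʳ-≤; *-monoʳ-≤; +-suc; m+n≤o⇒m≤o∸n; m+[n∸m]≡n; <⇒≤)
open import Data.Fin using (Fin; zero; suc; punchIn; _↑ˡ_; _↑ʳ_; splitAt; join; combine; remQuot; funToFin; finToFun; inject≤)
open import Data.Fin.Properties using (join-splitAt; remQuot-combine; combine-remQuot; funToFin-finToFin; finToFun-funToFin; inject≤-injective; injective⇒≤; nonZeroIndex; all?; ¬∀⟶∃¬)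
import Data.Fin.Properties as Fin
open import Data.Vec.Functional using (_++_; tail; insertAt; _∷_)
open import Data.Vec.Functional.Properties using (lookup-++ˡ; lookup-++ʳ; insertAt-lookup; insertAt-punchIn)
open import Data.Product using (∃; _,_; proj₁; uncurry)
open import Data.Sum using (_⊎_; inj₁; inj₂)
open import Data.Empty using (⊥-elim)
open import Function using (_∘_; flip)
open import Function.Bundles using (Inverse)
open import Function.Definitions using (Injective)
open import Relation.Nullary using (¬_; yes; no)
open import Relation.Binary.Definitions using (Decidable)
open import Relation.Binary.PropositionalEquality as ≡ using (_≡_)
open import Algebra.Bundles using (AbelianGroup)

byBlocks : ∀ {k m} (P : Fin (k Nat.+ m) → Set) →
           (∀ s → P (s ↑ˡ m)) → (∀ l → P (k ↑ʳ l)) → ∀ x → P x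
byBlocks {k} {m} P onLeft onRight x = ≡.subst P (join-splitAt k m x) (onPart (splitAt k x))
  where
  onPart : ∀ y → P (join k m y)
  onPart (inj₁ s) = onLeft s
  onPart (inj₂ l) = onRight l

module Tables where
  open Nat using (_*_; _^_)
  open ≡.≡-Reasoning

  funToFin-cong : ∀ {a b} {f g : Fin a → Fin b} → (∀ x → f x ≡ g x) → funToFin f ≡ funToFin g
  funToFin-cong {zero}  f≗g = ≡.refl
  funToFin-cong {suc a} f≗g = ≡.cong₂ combine (f≗g zero) (funToFin-cong (f≗g ∘ suc))

  toTable : ∀ {q m s} → Fin (q ^ (m * s)) → Fin s → Fin m → Fin q
  toTable i r l = finToFun i (combine l r)

  fromTable : ∀ {q m s} → (Fin s → Fin m → Fin q) → Fin (q ^ (m * s))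
  fromTable {s = s} g = funToFin (uncurry (flip g) ∘ remQuot s)

  toTable-fromTable : ∀ {q m s} (g : Fin s → Fin m → Fin q) r l → toTable (fromTable g) r l ≡ g r l
  toTable-fromTable {s = s} g r l = begin
    finToFun (fromTable g) (combine l r)    ≡⟨ finToFun-funToFin _ (combine l r) ⟩
    uncurry (flip g) (remQuot s (combine l r)) ≡⟨ ≡.cong (uncurry (flip g)) (remQuot-combine l r) ⟩
    g r l                                   ∎

  toTable-injective : ∀ {q m s} (i j : Fin (q ^ (m * s))) →
                      (∀ (r : Fin s) (l : Fin m) → toTable {q} i r l ≡ toTable j r l) → i ≡ j
  toTable-injective {q} {m} {s} i j sameTable = begin
    i                                 ≡⟨ funToFin-finToFin {m * s} {q} i ⟨
    funToFin (finToFun {q} {m * s} i) ≡⟨ funToFin-cong sameDigit ⟩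
    funToFin (finToFun {q} {m * s} j) ≡⟨ funToFin-finToFin {m * s} {q} j ⟩
    j                                 ∎
    where
    sameDigit : ∀ x → finToFun i x ≡ finToFun j x
    sameDigit x = ≡.subst (λ y → finToFun i y ≡ finToFun j y) (combine-remQuot {m} s x) (sameTable _ _)

  tables-pigeonhole : ∀ {q m s b M} .{{_ : NonZero q}} → s ≤ b →
                      (label : Fin M → Fin s → Fin m → Fin q) →
                      (∀ x y → (∀ r l → label x r l ≡ label y r l) → x ≡ y) → M ≤ q ^ (m * b)
  tables-pigeonhole {q} {m} {s} {b} {M} s≤b label distinct = injective⇒≤ {f = code} code-injective
    where
    room : q ^ (m * s) ≤ q ^ (m * b)
    room = ^-monoʳ-≤ q (*-monoʳ-≤ m s≤b)
    code : Fin M → Fin (q ^ (m * b))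
    code x = inject≤ (fromTable (label x)) room
    code-injective : Injective _≡_ _≡_ code
    code-injective {x} {y} codes≡ = distinct x y λ r l → begin
      label x r l                        ≡⟨ toTable-fromTable (label x) r l ⟨
      toTable (fromTable (label x)) r l  ≡⟨ ≡.cong (λ c → toTable c r l) (inject≤-injective room room _ _ codes≡) ⟩
      toTable (fromTable (label y)) r l  ≡⟨ toTable-fromTable (label y) r l ⟩
      label y r l                        ∎

open Tables using (toTable; toTable-injective; tables-pigeonhole)

module Over {q : ℕ} (F : FiniteField q) where
  open FiniteField F hiding (zero)
  open LinAlg F
  open Inverse card using (to; from; to-cong; strictlyInverseˡ; strictlyInverseʳ)
  open import Relation.Binary.Reasoning.Setoid setoid
  open import Algebra.Solver.Ring.NaturalCoefficients.Default commutativeSemiring using (solve; _:=_; _:+_; _:*_)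
  open import Algebra.Properties.Ring ring using (-‿distribˡ-*; -‿distribʳ-*)
  open import Algebra.Properties.AbelianGroup +-abelianGroup using (⁻¹-∙-comm)
  open import Algebra.Properties.Group (AbelianGroup.group +-abelianGroup)
    using () renaming (x∙y⁻¹≈ε⇒x≈y to x-y≈0⇒x≈y; x≈y⇒x∙y⁻¹≈ε to x≈y⇒x-y≈0)

  -- Equality in a finite field is decidable (compare the codes in Fin q); this drives pivot search.
  _≈?_ : Decidable _≈_
  x ≈? y with to x Fin.≟ to y
  ... | yes tx≡ty = yes (begin
    x           ≈⟨ strictlyInverseʳ x ⟨
    from (to x) ≡⟨ ≡.cong from tx≡ty ⟩
    from (to y) ≈⟨ strictlyInverseʳ y ⟩
    y           ∎)
  ... | no tx≢ty = no (tx≢ty ∘ to-cong)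

  from-injective : ∀ {a b} → from a ≈ from b → a ≡ b
  from-injective {a} {b} e = ≡.trans (≡.sym (strictlyInverseˡ a)) (≡.trans (to-cong e) (strictlyInverseˡ b))

  cancel : ∀ {p x} → ¬ p ≈ 0# → p * x ≈ 0# → x ≈ 0#
  cancel {p} {x} p≉0 px≈0 with inverse p p≉0
  ... | p⁻¹ , pp⁻¹≈1 = begin
    x               ≈⟨ *-identityˡ x ⟨
    1# * x          ≈⟨ *-congʳ pp⁻¹≈1 ⟨
    (p * p⁻¹) * x   ≈⟨ solve 3 (λ a b c → (a :* b) :* c := b :* (a :* c)) refl p p⁻¹ x ⟩
    p⁻¹ * (p * x)   ≈⟨ *-congˡ px≈0 ⟩
    p⁻¹ * 0#        ≈⟨ zeroʳ p⁻¹ ⟩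
    0#              ∎

  cancel-pair : ∀ a b → a * b + (- b) * a ≈ 0#
  cancel-pair a b = begin
    a * b + (- b) * a   ≈⟨ +-cong refl (-‿distribˡ-* b a) ⟨
    a * b + - (b * a)   ≈⟨ +-cong refl (-‿cong (*-comm b a)) ⟩
    a * b + - (a * b)   ≈⟨ -‿inverseʳ (a * b) ⟩
    0#                  ∎

  sum-cong : ∀ m {f g : Fin m → Carrier} → (∀ i → f i ≈ g i) → sumF m f ≈ sumF m g
  sum-cong zero    _   = refl
  sum-cong (suc m) f≈g = +-cong (f≈g zero) (sum-cong m (f≈g ∘ suc))

  sum-zero : ∀ m {f : Fin m → Carrier} → (∀ i → f i ≈ 0#) → sumF m f ≈ 0#
  sum-zero zero    _   = refl
  sum-zero (suc m) f≈0 = trans (+-cong (f≈0 zero) (sum-zero m (f≈0 ∘ suc))) (+-identityˡ 0#)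

  sum-+ : ∀ m (f g : Fin m → Carrier) → sumF m (λ i → f i + g i) ≈ sumF m f + sumF m g
  sum-+ zero    f g = sym (+-identityˡ 0#)
  sum-+ (suc m) f g = trans (+-cong refl (sum-+ m (f ∘ suc) (g ∘ suc)))
    (solve 4 (λ a b c d → (a :+ b) :+ (c :+ d) := (a :+ c) :+ (b :+ d)) refl (f zero) (g zero) _ _)

  sum-*ˡ : ∀ m a (f : Fin m → Carrier) → sumF m (λ i → a * f i) ≈ a * sumF m f
  sum-*ˡ zero    a f = sym (zeroʳ a)
  sum-*ˡ (suc m) a f = trans (+-cong refl (sum-*ˡ m a (f ∘ suc))) (sym (distribˡ a _ _))

  sum-combination : ∀ m a b (f g : Fin m → Carrier) →
                    sumF m (λ i → a * f i + b * g i) ≈ a * sumF m f + b * sumF m g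
  sum-combination m a b f g = trans (sum-+ m _ _) (+-cong (sum-*ˡ m a f) (sum-*ˡ m b g))

  sum-neg : ∀ m (f : Fin m → Carrier) → sumF m (λ i → - f i) ≈ - sumF m f
  sum-neg zero    f = sym (trans (sym (+-identityʳ (- 0#))) (-‿inverseˡ 0#))
  sum-neg (suc m) f = trans (+-cong refl (sum-neg m (f ∘ suc))) (⁻¹-∙-comm _ _)

  sum-swap : ∀ a b (f : Fin a → Fin b → Carrier) →
             sumF a (λ i → sumF b (f i)) ≈ sumF b (λ j → sumF a (λ i → f i j))
  sum-swap zero    b f = sym (sum-zero b (λ _ → refl))
  sum-swap (suc a) b f = trans (+-cong refl (sum-swap a b (f ∘ suc))) (sym (sum-+ b (f zero) _))

  sum-punchIn : ∀ t (r : Fin (suc t)) (f : Fin (suc t) → Carrier) →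
                sumF (suc t) f ≈ f r + sumF t (f ∘ punchIn r)
  sum-punchIn t       zero    f = refl
  sum-punchIn (suc t) (suc r) f = trans (+-cong refl (sum-punchIn t r (f ∘ suc)))
    (solve 3 (λ a b c → a :+ (b :+ c) := b :+ (a :+ c)) refl _ _ _)

  dot : ∀ {k} → Vec k → Vec k → Carrier
  dot {k} x y = sumF k (λ j → x j * y j)

  dot-congˡ : ∀ {k} {x x′ : Vec k} (y : Vec k) → x ≈ᵥ x′ → dot x y ≈ dot x′ y
  dot-congˡ {k} y x≈x′ = sum-cong k (λ j → *-congʳ (x≈x′ j))

  dot-zeroˡ : ∀ {k} {x : Vec k} (y : Vec k) → x ≈ᵥ zeroᵥ → dot x y ≈ 0#
  dot-zeroˡ {k} y x≈0 = sum-zero k (λ j → trans (*-congʳ (x≈0 j)) (zeroˡ _))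

  dot-zeroʳ : ∀ {k} (x : Vec k) {y : Vec k} → y ≈ᵥ zeroᵥ → dot x y ≈ 0#
  dot-zeroʳ {k} x y≈0 = sum-zero k (λ j → trans (*-congˡ (y≈0 j)) (zeroʳ _))

  dot-combinationˡ : ∀ {k} a b (u v y : Vec k) →
                     dot (λ j → a * u j + b * v j) y ≈ a * dot u y + b * dot v y
  dot-combinationˡ {k} a b u v y = trans
    (sum-cong k (λ j → solve 5 (λ a b u v y → (a :* u :+ b :* v) :* y := a :* (u :* y) :+ b :* (v :* y))
      refl a b (u j) (v j) (y j)))
    (sum-combination k a b _ _)

  dot-−ʳ : ∀ {k} (x y z : Vec k) → dot x (λ j → y j - z j) ≈ dot x y - dot x z
  dot-−ʳ {k} x y z = begin
    dot x (λ j → y j - z j)                       ≈⟨ sum-cong k (λ j → distribˡ (x j) (y j) (- z j)) ⟩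
    sumF k (λ j → x j * y j + x j * (- z j))      ≈⟨ sum-+ k _ _ ⟩
    dot x y + sumF k (λ j → x j * (- z j))        ≈⟨ +-cong refl (sum-cong k (λ j → -‿distribʳ-* (x j) (z j))) ⟨
    dot x y + sumF k (λ j → - (x j * z j))        ≈⟨ +-cong refl (sum-neg k _) ⟩
    dot x y - dot x z                             ∎

  dot-lincombˡ : ∀ {t k} (c : Fin t → Carrier) (X : Mat t k) (y : Vec k) →
                 dot (lincomb c X) y ≈ sumF t (λ i → c i * dot (X i) y)
  dot-lincombˡ {t} {k} c X y = begin
    sumF k (λ s → lincomb c X s * y s)                ≈⟨ sum-cong k (λ s → *-comm _ _) ⟩
    sumF k (λ s → y s * lincomb c X s)                ≈⟨ sum-cong k (λ s → sum-*ˡ t (y s) _) ⟨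
    sumF k (λ s → sumF t (λ i → y s * (c i * X i s))) ≈⟨ sum-swap k t _ ⟩
    sumF t (λ i → sumF k (λ s → y s * (c i * X i s)))
      ≈⟨ sum-cong t (λ i → sum-cong k (λ s → solve 3 (λ y c x → y :* (c :* x) := c :* (x :* y)) refl (y s) (c i) (X i s))) ⟩
    sumF t (λ i → sumF k (λ s → c i * (X i s * y s))) ≈⟨ sum-cong t (λ i → sum-*ˡ k (c i) _) ⟩
    sumF t (λ i → c i * dot (X i) y)                  ∎

  dot-tail : ∀ {k} (x d : Vec (suc k)) → x zero ≈ 0# → dot x d ≈ 0# → dot (tail x) (tail d) ≈ 0#
  dot-tail x d x₀≈0 xd≈0 = begin
    dot (tail x) (tail d)                      ≈⟨ +-identityˡ _ ⟨
    0# + dot (tail x) (tail d)                 ≈⟨ +-cong (trans (*-congʳ x₀≈0) (zeroˡ _)) refl ⟨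
    x zero * d zero + dot (tail x) (tail d)    ≈⟨ xd≈0 ⟩
    0#                                         ∎

  lincomb-scale : ∀ {t k} a (c : Fin t → Carrier) (X : Mat t k) j →
                  lincomb (λ i → a * c i) X j ≈ a * lincomb c X j
  lincomb-scale {t} a c X j = trans (sum-cong t (λ i → *-assoc _ _ _)) (sum-*ˡ t a _)

  lincomb-insertAt : ∀ {t k} (c : Fin t → Carrier) (r : Fin (suc t)) v (X : Mat (suc t) k) j →
                     lincomb (insertAt c r v) X j ≈ v * X r j + lincomb c (X ∘ punchIn r) j
  lincomb-insertAt {t} c r v X j = trans (sum-punchIn t r (λ i → insertAt c r v i * X i j))
    (+-cong (*-congʳ (reflexive (insertAt-lookup c r v)))
            (sum-cong t (λ i → *-congʳ (reflexive (insertAt-punchIn c r v i)))))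

  δ : ∀ {k} → Fin k → Fin k → Carrier
  δ zero    zero    = 1#
  δ zero    (suc _) = 0#
  δ (suc _) zero    = 0#
  δ (suc r) (suc s) = δ r s

  δ-sym : ∀ {k} (r s : Fin k) → δ r s ≡ δ s r
  δ-sym zero    zero    = ≡.refl
  δ-sym zero    (suc _) = ≡.refl
  δ-sym (suc _) zero    = ≡.refl
  δ-sym (suc r) (suc s) = δ-sym r s

  dot-δ : ∀ {k} (r : Fin k) (y : Vec k) → dot (δ r) y ≈ y r
  dot-δ {suc k} zero    y = trans (+-cong (*-identityˡ _) (sum-zero k (λ _ → zeroˡ _))) (+-identityʳ _)
  dot-δ {suc k} (suc r) y = trans (+-cong (zeroˡ _) (dot-δ r (tail y))) (+-identityˡ _)

  Annihilates : ∀ {t k} → Mat t k → Vec k → Set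
  Annihilates X d = ∀ i → dot (X i) d ≈ 0#

  Determines : ∀ {t k s} → Mat t k → (Fin s → Fin k) → Set
  Determines X σ = ∀ d → Annihilates X d → (∀ a → d (σ a) ≈ 0#) → d ≈ᵥ zeroᵥ

  -- At most k - t coordinates determining the kernel of the t × k system X
  -- (the free variables of its reduced row echelon form).
  record KernelCoordinates {t k} (X : Mat t k) : Set where
    field
      size       : ℕ
      coordinate : Fin size → Fin k
      size+t≤k   : size Nat.+ t ≤ k
      determines : Determines X coordinate

  firstColumn : ∀ {t k} (X : Mat t (suc k)) → (∀ i → X i zero ≈ 0#) ⊎ ∃ λ r → ¬ X r zero ≈ 0#
  firstColumn {t} X with all? (λ i → X i zero ≈? 0#)
  ... | yes column≈0 = inj₁ column≈0
  ... | no  column≉0 = inj₂ (¬∀⟶∃¬ t _ (λ i → X i zero ≈? 0#) column≉0)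

  dropFirstColumn : ∀ {t k} → Mat t (suc k) → Mat t k
  dropFirstColumn X = tail ∘ X

  dropZeroColumn-independent : ∀ {t k} (X : Mat t (suc k)) → LinIndep X → (∀ i → X i zero ≈ 0#) →
                               LinIndep (dropFirstColumn X)
  dropZeroColumn-independent {t} X ind column≈0 c cX′≈0 = ind c cX≈0
    where
    cX≈0 : lincomb c X ≈ᵥ zeroᵥ
    cX≈0 zero    = sum-zero t (λ i → trans (*-congˡ (column≈0 i)) (zeroʳ _))
    cX≈0 (suc j) = cX′≈0 j

  zeroColumnCase : ∀ {t k} (X : Mat t (suc k)) → (∀ i → X i zero ≈ 0#) →
                   KernelCoordinates (dropFirstColumn X) → KernelCoordinates X
  zeroColumnCase X column≈0 K = record
    { size       = suc size
    ; coordinate = zero ∷ (suc ∘ coordinate)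
    ; size+t≤k   = s≤s size+t≤k
    ; determines = vanish }
    where
    open KernelCoordinates K
    vanish : Determines X (zero ∷ (suc ∘ coordinate))
    vanish d Xd≈0 dσ≈0 zero    = dσ≈0 zero
    vanish d Xd≈0 dσ≈0 (suc j) =
      determines (tail d) (λ i → dot-tail (X i) d (column≈0 i) (Xd≈0 i)) (dσ≈0 ∘ suc) j

  pivotCombination : ∀ {t k} → Mat (suc t) (suc k) → Fin (suc t) → Mat t (suc k)
  pivotCombination X r i j = X r zero * X (punchIn r i) j + (- X (punchIn r i) zero) * X r j

  eliminate : ∀ {t k} → Mat (suc t) (suc k) → Fin (suc t) → Mat t k
  eliminate X r = dropFirstColumn (pivotCombination X r)

  pivotCombination-first : ∀ {t k} (X : Mat (suc t) (suc k)) r i → pivotCombination X r i zero ≈ 0#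
  pivotCombination-first X r i = cancel-pair (X r zero) (X (punchIn r i) zero)

  lincomb-pivotCombination : ∀ {t k} (X : Mat (suc t) (suc k)) r (c : Fin t → Carrier) j →
    lincomb c (pivotCombination X r) j ≈
      X r zero * lincomb c (X ∘ punchIn r) j + X r j * sumF t (λ i → c i * (- X (punchIn r i) zero))
  lincomb-pivotCombination {t} X r c j = trans
    (sum-cong t (λ i → solve 5 (λ c p y m x → c :* (p :* y :+ m :* x) := p :* (c :* y) :+ x :* (c :* m))
      refl (c i) (X r zero) (X (punchIn r i) j) (- X (punchIn r i) zero) (X r j)))
    (sum-combination t _ _ _ _)

  -- A dependency among the eliminated rows lifts to one among the rows of X (pivot p ≠ 0 cancels).
  eliminate-independent : ∀ {t k} (X : Mat (suc t) (suc k)) r → LinIndep X → ¬ X r zero ≈ 0# →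
                          LinIndep (eliminate X r)
  eliminate-independent {t} X r ind p≉0 c′ c′X′≈0 i =
    cancel p≉0 (trans (reflexive (≡.sym (insertAt-punchIn (λ i → p * c′ i) r b i)))
                      (ind c cX≈0 (punchIn r i)))
    where
    p = X r zero
    Y = X ∘ punchIn r
    b = sumF t (λ i → c′ i * (- Y i zero))
    -- c′ lifted to the rows of X: the same combination, written in terms of the original rows
    c = insertAt (λ i → p * c′ i) r b
    c′P≈0 : lincomb c′ (pivotCombination X r) ≈ᵥ zeroᵥ
    c′P≈0 zero    = sum-zero t (λ i → trans (*-congˡ (pivotCombination-first X r i)) (zeroʳ _))
    c′P≈0 (suc j) = c′X′≈0 j
    cX≈0 : lincomb c X ≈ᵥ zeroᵥ
    cX≈0 j = begin
      lincomb c X j                              ≈⟨ lincomb-insertAt _ r b X j ⟩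
      b * X r j + lincomb (λ i → p * c′ i) Y j   ≈⟨ +-cong refl (lincomb-scale p c′ Y j) ⟩
      b * X r j + p * lincomb c′ Y j             ≈⟨ +-comm _ _ ⟩
      p * lincomb c′ Y j + b * X r j             ≈⟨ +-cong refl (*-comm b _) ⟩
      p * lincomb c′ Y j + X r j * b             ≈⟨ lincomb-pivotCombination X r c′ j ⟨
      lincomb c′ (pivotCombination X r) j        ≈⟨ c′P≈0 j ⟩
      0#                                         ∎

  eliminate-annihilates : ∀ {t k} (X : Mat (suc t) (suc k)) r {d} → Annihilates X d →
                          Annihilates (eliminate X r) (tail d)
  eliminate-annihilates X r {d} Xd≈0 i =
    dot-tail (pivotCombination X r i) d (pivotCombination-first X r i) (begin
      dot (pivotCombination X r i) d                 ≈⟨ dot-combinationˡ p m (X (punchIn r i)) (X r) d ⟩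
      p * dot (X (punchIn r i)) d + m * dot (X r) d  ≈⟨ +-cong (*-congˡ (Xd≈0 (punchIn r i))) (*-congˡ (Xd≈0 r)) ⟩
      p * 0# + m * 0#                                ≈⟨ +-cong (zeroʳ p) (zeroʳ m) ⟩
      0# + 0#                                        ≈⟨ +-identityʳ 0# ⟩
      0#                                             ∎)
    where
    p = X r zero
    m = - X (punchIn r i) zero

  -- The reduced system's coordinates (shifted) suffice: the pivot row then forces d₀ = 0.
  pivotCase : ∀ {t k} (X : Mat (suc t) (suc k)) r → ¬ X r zero ≈ 0# →
              KernelCoordinates (eliminate X r) → KernelCoordinates X
  pivotCase {t} {k} X r p≉0 K = record
    { size       = size
    ; coordinate = suc ∘ coordinate
    ; size+t≤k   = ≡.subst (_≤ suc k) (≡.sym (+-suc size t)) (s≤s size+t≤k)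
    ; determines = vanish }
    where
    open KernelCoordinates K
    vanish : Determines X (suc ∘ coordinate)
    vanish d Xd≈0 dσ≈0 = d≈0
      where
      tail≈0 : tail d ≈ᵥ zeroᵥ
      tail≈0 = determines (tail d) (eliminate-annihilates X r {d} Xd≈0) dσ≈0
      d≈0 : d ≈ᵥ zeroᵥ
      d≈0 zero    = cancel p≉0 (begin
        X r zero * d zero                              ≈⟨ +-identityʳ _ ⟨
        X r zero * d zero + 0#                         ≈⟨ +-cong refl (dot-zeroʳ (tail (X r)) tail≈0) ⟨
        X r zero * d zero + dot (tail (X r)) (tail d)  ≈⟨ Xd≈0 r ⟩
        0#                                             ∎)
      d≈0 (suc j) = tail≈0 j

  kernelCoordinates : ∀ {t k} (X : Mat t k) → LinIndep X → KernelCoordinates X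
  kernelCoordinates {zero} {zero} X ind = record
    { size = 0 ; coordinate = λ () ; size+t≤k = z≤n ; determines = λ _ _ _ () }
  kernelCoordinates {suc t} {zero} X ind = ⊥-elim (1≉0 (ind (λ _ → 1#) (λ ()) zero))
  kernelCoordinates {t} {suc k} X ind with firstColumn X
  kernelCoordinates {t} {suc k} X ind | inj₁ column≈0 =
    zeroColumnCase X column≈0
      (kernelCoordinates (dropFirstColumn X) (dropZeroColumn-independent X ind column≈0))
  kernelCoordinates {suc t} {suc k} X ind | inj₂ (r , p≉0) =
    pivotCase X r p≉0 (kernelCoordinates (eliminate X r) (eliminate-independent X r ind p≉0))

  module Graph (k m : ℕ) where

    left : Vec (k Nat.+ m) → Vec k
    left u s = u (s ↑ˡ m)

    right : Vec (k Nat.+ m) → Vec m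
    right u l = u (k ↑ʳ l)

    _⋆_ : Vec k → (Fin k → Vec m) → Vec m
    (x ⋆ A) l = dot x (λ s → A s l)

    graphRow : (Fin k → Vec m) → Mat k (k Nat.+ m)
    graphRow A r = δ r ++ A r

    lincomb-graphˡ : ∀ A c s → lincomb c (graphRow A) (s ↑ˡ m) ≈ c s
    lincomb-graphˡ A c s = begin
      sumF k (λ r → c r * (δ r ++ A r) (s ↑ˡ m)) ≈⟨ sum-cong k (λ r → *-congˡ (reflexive (lookup-++ˡ (δ r) (A r) s))) ⟩
      sumF k (λ r → c r * δ r s)                 ≈⟨ sum-cong k (λ r → trans (*-comm _ _) (*-congʳ (reflexive (δ-sym r s)))) ⟩
      dot (δ s) c                                ≈⟨ dot-δ s c ⟩
      c s                                        ∎

    lincomb-graphʳ : ∀ A c l → lincomb c (graphRow A) (k ↑ʳ l) ≈ (c ⋆ A) l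
    lincomb-graphʳ A c l = sum-cong k (λ r → *-congˡ (reflexive (lookup-++ʳ (δ r) (A r) l)))

    graphRow-independent : ∀ A → LinIndep (graphRow A)
    graphRow-independent A c cG≈0 s = trans (sym (lincomb-graphˡ A c s)) (cG≈0 (s ↑ˡ m))

    graphBlock : (Fin k → Vec m) → Subspace (k Nat.+ m) k
    graphBlock A = subspace (graphRow A) (graphRow-independent A)

    ∈graph : ∀ A {u} → u ∈span graphRow A → ∀ l → (left u ⋆ A) l ≈ right u l
    ∈graph A {u} (c , cG≈u) l = begin
      (left u ⋆ A) l                ≈⟨ dot-congˡ _ (λ s → trans (sym (cG≈u (s ↑ˡ m))) (lincomb-graphˡ A c s)) ⟩
      (c ⋆ A) l                     ≈⟨ lincomb-graphʳ A c l ⟨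
      lincomb c (graphRow A) (k ↑ʳ l) ≈⟨ cG≈u (k ↑ʳ l) ⟩
      right u l                     ∎

    graph-injective : ∀ A B → graphRow A ⊆span graphRow B → ∀ r l → A r l ≈ B r l
    graph-injective A B A⊆B r l = begin
      A r l                       ≡⟨ lookup-++ʳ (δ r) (A r) l ⟨
      right (graphRow A r) l      ≈⟨ ∈graph B (A⊆B r) l ⟨
      (left (graphRow A r) ⋆ B) l ≈⟨ dot-congˡ _ (λ s → reflexive (lookup-++ˡ (δ r) (A r) s)) ⟩
      (δ r ⋆ B) l                 ≈⟨ dot-δ r _ ⟩
      B r l                       ∎

    module Through {t} (T : Subspace (k Nat.+ m) t) where

      X : Mat t k
      X i = left (basis T i)

      -- A dependency among the left parts extends to the right parts (right u = left u ⋆ A).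
      X-independent : ∀ A → T ≤ₛ graphBlock A → LinIndep X
      X-independent A T≤A c cX≈0 = indep T c (byBlocks _ cX≈0 onRight)
        where
        onRight : ∀ l → lincomb c (basis T) (k ↑ʳ l) ≈ 0#
        onRight l = begin
          sumF t (λ i → c i * right (basis T i) l) ≈⟨ sum-cong t (λ i → *-congˡ (∈graph A (T≤A i) l)) ⟨
          sumF t (λ i → c i * (X i ⋆ A) l)         ≈⟨ dot-lincombˡ c X _ ⟨
          (lincomb c X ⋆ A) l                      ≈⟨ dot-zeroˡ _ cX≈0 ⟩
          0#                                       ∎

      difference-annihilated : ∀ A B → T ≤ₛ graphBlock A → T ≤ₛ graphBlock B →
                               ∀ l → Annihilates X (λ s → A s l - B s l)
      difference-annihilated A B T≤A T≤B l i = begin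
        dot (X i) (λ s → A s l - B s l)  ≈⟨ dot-−ʳ (X i) _ _ ⟩
        (X i ⋆ A) l - (X i ⋆ B) l        ≈⟨ +-cong (∈graph A (T≤A i) l) (-‿cong (∈graph B (T≤B i) l)) ⟩
        right (basis T i) l - right (basis T i) l ≈⟨ -‿inverseʳ _ ⟩
        0#                               ∎

      coincide : (K : KernelCoordinates X) → let open KernelCoordinates K in
                 ∀ A B → T ≤ₛ graphBlock A → T ≤ₛ graphBlock B →
                 (∀ a l → A (coordinate a) l ≈ B (coordinate a) l) → ∀ s l → A s l ≈ B s l
      coincide K A B T≤A T≤B agree s l = x-y≈0⇒x≈y _ _
        (determines _ (difference-annihilated A B T≤A T≤B l) (λ a → x≈y⇒x-y≈0 (agree a l)) s)
        where open KernelCoordinates K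

    matrixOf : Fin (q Nat.^ (m Nat.* k)) → Fin k → Vec m
    matrixOf i r l = from (toTable i r l)

    matrixOf-injective : ∀ i j → (∀ r l → matrixOf i r l ≈ matrixOf j r l) → i ≡ j
    matrixOf-injective i j same = toTable-injective i j (λ r l → from-injective (same r l))

    block : Fin (q Nat.^ (m Nat.* k)) → Subspace (k Nat.+ m) k
    block i = graphBlock (matrixOf i)

    -- At most q^(m(k-t)) blocks contain a given t-subspace T: a block through T is determined by
    -- the rows of its matrix at the kernel coordinates of X.
    multiplicity : ∀ {t} (T : Subspace (k Nat.+ m) t) M (f : Fin M → Fin (q Nat.^ (m Nat.* k))) →
                   Injective _≡_ _≡_ f → (∀ x → T ≤ₛ block (f x)) → M ≤ q Nat.^ (m Nat.* (k Nat.∸ t))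
    multiplicity T zero    f f-injective T≤f = z≤n
    multiplicity {t} T (suc M) f f-injective T≤f =
      tables-pigeonhole {{nonZeroIndex (to 0#)}} (m+n≤o⇒m≤o∸n size size+t≤k) label labels-distinct
      where
      open Through T
      K = kernelCoordinates X (X-independent _ (T≤f zero))
      open KernelCoordinates K
      label : Fin (suc M) → Fin size → Fin m → Fin q
      label x a = toTable (f x) (coordinate a)
      labels-distinct : ∀ x y → (∀ a l → label x a l ≡ label y a l) → x ≡ y
      labels-distinct x y same = f-injective (matrixOf-injective (f x) (f y)
        (coincide K _ _ (T≤f x) (T≤f y)
          (λ a l → reflexive (≡.cong from (same a l)))))

    graphPacking : ∀ t → Packing (k Nat.+ m) k t (q Nat.^ (m Nat.* (k Nat.∸ t))) (q Nat.^ (m Nat.* k))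
    graphPacking t = record
      { block    = block
      ; distinct = λ i j same → matrixOf-injective i j (graph-injective _ _ (proj₁ same))
      ; packing  = multiplicity }

open import Data.Nat using (_<_; _*_; _∸_; _^_)

lemma4 : ∀ {q : ℕ} (F : FiniteField q) (n k t : ℕ) →
           1 ≤ t → t ≤ k → k < n →
           LinAlg.A≥ F n k t (q ^ ((n ∸ k) * (k ∸ t))) (q ^ ((n ∸ k) * k))
lemma4 {q} F n k t _ _ k<n =
  ≡.subst (λ N → LinAlg.Packing F N k t (q ^ ((n ∸ k) * (k ∸ t))) (q ^ ((n ∸ k) * k)))
    (m+[n∸m]≡n (<⇒≤ k<n))
    (Over.Graph.graphPacking F k (n ∸ k) t)
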